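{- Let $n$ and $k$ be positive integers. Then $$(n!!)^k+n^k=(k!!)^n+k^n$$ holds if and only if $k=n$.
   Context: For a positive integer $m$, the double factorial $m!!$ is the product of all positive integers $\le m$ having the same parity as $m$, i.e. $m!!=m(m-2)(m-4)\cdots$, ending in $1$ if $m$ is odd and in $2$ if $m$ is even. -}

module Defs where

open import Data.Nat using (ℕ; zero; suc; _*_)

_!! : ℕ → ℕ
zero !! = 1
suc zero !! = 1
suc (suc m) !! = suc (suc m) * (m !!)

{-# OPTIONS --safe #-}
-- For 1 ≤ n < k one proves the stronger bound n!!^k + n^k ≤ k!!^n (`Dominated n k`), except for
-- (n, k) = (2, 3), which is checked directly.  Domination passes from k to k + 2 because
-- (n!!)² ≤ (n+1)^n ≤ (k+2)^n, so only k = n + 1 and k = n + 2 remain.  For k = n + 2 it suffices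
-- that 2 (n!!)² ≤ (n+2)^n; for k = n + 1 (and n ≥ 4) that 2n ≤ n!! and 3 (n!!)^(n+1) ≤ 2 ((n+1)!!)^n,
-- the latter by induction in steps of two using Bernoulli's inequality 2 N^N ≤ (N+1)^N.
module Submission where

open import Defs
open import Data.Nat using (ℕ; _+_; _^_; _≥_)
open import Relation.Binary.PropositionalEquality using (_≡_)
open import Function.Bundles using (_⇔_)

open import Data.Nat using (zero; suc; _*_; _≤_; _<_; z≤n; s≤s; _≟_; NonZero; >-nonZero)
open import Data.Nat.Properties
open import Data.Nat.Tactic.RingSolver using (solve-∀)
open import Data.Product using (_,_)
open import Function.Bundles using (mk⇔)
open import Relation.Binary.Definitions using (tri<; tri≈; tri>)
open import Relation.Binary.PropositionalEquality using (_≢_; refl; sym; trans; cong; cong₂; subst; ≢-sym)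
open import Relation.Nullary using (yes; no; contradiction)

open ≤-Reasoning

^-distrib-* : ∀ m n o → (m * n) ^ o ≡ m ^ o * n ^ o
^-distrib-* m n zero    = refl
^-distrib-* m n (suc o) =
  trans (cong (m * n *_) (^-distrib-* m n o)) ([m*n]*[o*p]≡[m*o]*[n*p] m n (m ^ o) (n ^ o))

bernoulli : ∀ m j → m ^ j * (m + j) ≤ m * suc m ^ j
bernoulli m zero rewrite +-identityʳ m = ≤-reflexive (*-comm 1 m)
bernoulli m (suc j) = begin
    m * m ^ j * (m + suc j)                ≤⟨ m≤m+n _ (m ^ j * j) ⟩
    m * m ^ j * (m + suc j) + m ^ j * j    ≡⟨ regroup m (m ^ j) j ⟩
    suc m * (m ^ j * (m + j))              ≤⟨ *-monoʳ-≤ (suc m) (bernoulli m j) ⟩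
    suc m * (m * suc m ^ j)                ≡⟨ swap (suc m) m (suc m ^ j) ⟩
    m * (suc m * suc m ^ j)                ∎
  where
  regroup : ∀ m p j → m * p * (m + suc j) + p * j ≡ suc m * (p * (m + j))
  regroup = solve-∀
  swap : ∀ a b c → a * (b * c) ≡ b * (a * c)
  swap = solve-∀

2*[1+m]^[1+m]≤[2+m]^[1+m] : ∀ m → 2 * suc m ^ suc m ≤ suc (suc m) ^ suc m
2*[1+m]^[1+m]≤[2+m]^[1+m] m = *-cancelˡ-≤ (suc m) (begin
    suc m * (2 * X)        ≡⟨ regroup (suc m) X ⟩
    X * (suc m + suc m)    ≤⟨ bernoulli (suc m) (suc m) ⟩
    suc m * suc (suc m) ^ suc m ∎)
  where
  X = suc m ^ suc m
  regroup : ∀ a x → a * (2 * x) ≡ x * (a + a)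
  regroup = solve-∀

n!!≢0 : ∀ n → NonZero (n !!)
n!!≢0 zero          = _
n!!≢0 (suc zero)    = _
n!!≢0 (suc (suc m)) = m*n≢0 (suc (suc m)) (m !!) {{_}} {{n!!≢0 m}}

n≤n!! : ∀ n → n ≤ n !!
n≤n!! zero          = z≤n
n≤n!! (suc zero)    = ≤-refl
n≤n!! (suc (suc m)) = m≤m*n (suc (suc m)) (m !!) {{n!!≢0 m}}

2*n≤n!! : ∀ n → 4 ≤ n → 2 * n ≤ n !!
2*n≤n!! n@(suc (suc m)) (s≤s (s≤s 2≤m)) = begin
  2 * n     ≡⟨ *-comm 2 n ⟩
  n * 2     ≤⟨ *-monoʳ-≤ n (≤-trans 2≤m (n≤n!! m)) ⟩
  n * m !!  ∎

n!!²≤[1+n]^n : ∀ n → n !! * n !! ≤ suc n ^ n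
n!!²≤[1+n]^n zero          = ≤-refl
n!!²≤[1+n]^n (suc zero)    = s≤s z≤n
n!!²≤[1+n]^n (suc (suc m)) = begin
    (2 + m) * A * ((2 + m) * A)          ≡⟨ [m*n]*[o*p]≡[m*o]*[n*p] (2 + m) A (2 + m) A ⟩
    (2 + m) * (2 + m) * (A * A)          ≤⟨ *-mono-≤ (*-mono-≤ (n≤1+n (2 + m)) (n≤1+n (2 + m))) A²≤[3+m]^m ⟩
    (3 + m) * (3 + m) * (3 + m) ^ m      ≡⟨ *-assoc (3 + m) (3 + m) ((3 + m) ^ m) ⟩
    (3 + m) ^ (2 + m)                    ∎
  where
  A = m !!
  A²≤[3+m]^m : A * A ≤ (3 + m) ^ m
  A²≤[3+m]^m = ≤-trans (n!!²≤[1+n]^n m) (^-monoˡ-≤ m (m≤n+m (suc m) 2))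

2*n!!²≤[2+n]^n : ∀ n → 2 ≤ n → 2 * (n !! * n !!) ≤ (2 + n) ^ n
2*n!!²≤[2+n]^n 1 (s≤s ())
2*n!!²≤[2+n]^n 2 _ = ≤ᵇ⇒≤ 8 16 _
2*n!!²≤[2+n]^n 3 _ = ≤ᵇ⇒≤ 18 125 _
2*n!!²≤[2+n]^n (suc (suc m@(suc (suc _)))) _ = begin
    2 * (n * A * (n * A))          ≡⟨ regroup n A ⟩
    n * n * (2 * (A * A))          ≤⟨ *-monoʳ-≤ (n * n) (2*n!!²≤[2+n]^n m (s≤s (s≤s z≤n))) ⟩
    n * n * n ^ m                  ≤⟨ *-mono-≤ (*-mono-≤ n≤2+n n≤2+n) (^-monoˡ-≤ m n≤2+n) ⟩
    (2 + n) * (2 + n) * (2 + n) ^ m  ≡⟨ *-assoc (2 + n) (2 + n) ((2 + n) ^ m) ⟩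
    (2 + n) ^ n                    ∎
  where
  n = 2 + m
  A = m !!
  n≤2+n = m≤n+m n 2
  regroup : ∀ a b → 2 * (a * b * (a * b)) ≡ a * a * (2 * (b * b))
  regroup = solve-∀

[2+n]*n!!²≤2*[1+n]!!² : ∀ n → (2 + n) * (n !! * n !!) ≤ 2 * (suc n !! * suc n !!)
[2+n]*n!!²≤2*[1+n]!!² zero          = ≤-refl
[2+n]*n!!²≤2*[1+n]!!² (suc zero)    = ≤ᵇ⇒≤ 3 8 _
[2+n]*n!!²≤2*[1+n]!!² (suc (suc m)) = begin
    (4 + m) * ((2 + m) * A * ((2 + m) * A))    ≡⟨ regroupˡ m A ⟩
    (4 + m) * (2 + m) * ((2 + m) * (A * A))    ≤⟨ *-mono-≤ (≤-trans (m≤m+n _ 1) (≤-reflexive (square m)))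
                                                          ([2+n]*n!!²≤2*[1+n]!!² m) ⟩
    (3 + m) * (3 + m) * (2 * (B * B))          ≡⟨ regroupʳ (3 + m) B ⟩
    2 * ((3 + m) * B * ((3 + m) * B))          ∎
  where
  A = m !!
  B = suc m !!
  regroupˡ : ∀ m a → (4 + m) * ((2 + m) * a * ((2 + m) * a)) ≡ (4 + m) * (2 + m) * ((2 + m) * (a * a))
  regroupˡ = solve-∀
  regroupʳ : ∀ c b → c * c * (2 * (b * b)) ≡ 2 * (c * b * (c * b))
  regroupʳ = solve-∀
  square : ∀ m → (4 + m) * (2 + m) + 1 ≡ (3 + m) * (3 + m)
  square = solve-∀

3*n!!^[1+n]≤2*[1+n]!!^n : ∀ n → 3 ≤ n → 3 * n !! ^ suc n ≤ 2 * suc n !! ^ n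
3*n!!^[1+n]≤2*[1+n]!!^n 1 (s≤s ())
3*n!!^[1+n]≤2*[1+n]!!^n 2 (s≤s (s≤s ()))
3*n!!^[1+n]≤2*[1+n]!!^n 3 _ = ≤ᵇ⇒≤ 243 1024 _
3*n!!^[1+n]≤2*[1+n]!!^n 4 _ = ≤ᵇ⇒≤ 98304 101250 _
3*n!!^[1+n]≤2*[1+n]!!^n (suc (suc m@(suc (suc (suc _))))) _ = begin
    3 * ((2 + m) * A) ^ (3 + m)                 ≡⟨ cong (3 *_) (^-distrib-* (2 + m) A (3 + m)) ⟩
    3 * ((2 + m) * Y * (A * (A * A ^ suc m)))   ≡⟨ regroupˡ (2 + m) Y A (A ^ suc m) ⟩
    Y * ((2 + m) * (A * A)) * (3 * A ^ suc m)   ≤⟨ *-mono-≤ (*-monoʳ-≤ Y ([2+n]*n!!²≤2*[1+n]!!² m))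
                                                           (3*n!!^[1+n]≤2*[1+n]!!^n m (s≤s (s≤s (s≤s z≤n)))) ⟩
    Y * (2 * (B * B)) * (2 * B ^ m)             ≡⟨ regroupʳ Y B (B ^ m) ⟩
    2 * (2 * Y * B ^ (2 + m))                   ≤⟨ *-monoʳ-≤ 2 (*-monoˡ-≤ (B ^ (2 + m))
                                                                (2*[1+m]^[1+m]≤[2+m]^[1+m] (suc m))) ⟩
    2 * ((3 + m) ^ (2 + m) * B ^ (2 + m))       ≡⟨ cong (2 *_) (^-distrib-* (3 + m) B (2 + m)) ⟨
    2 * ((3 + m) * B) ^ (2 + m)                 ∎
  where
  A = m !!
  B = suc m !!
  Y = (2 + m) ^ (2 + m)
  regroupˡ : ∀ c y a x → 3 * (c * y * (a * (a * x))) ≡ y * (c * (a * a)) * (3 * x)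
  regroupˡ = solve-∀
  regroupʳ : ∀ y b z → y * (2 * (b * b)) * (2 * z) ≡ 2 * (2 * y * (b * (b * z)))
  regroupʳ = solve-∀

Dominated : ℕ → ℕ → Set
Dominated n k = n !! ^ k + n ^ k ≤ k !! ^ n

dominated⇒< : ∀ {n k} → 0 < k → Dominated n k → n !! ^ k + n ^ k < k !! ^ n + k ^ n
dominated⇒< {n} {k} 0<k dom = ≤-<-trans dom (m<m+n (k !! ^ n) (m^n>0 k {{>-nonZero 0<k}} n))

dominated-+2 : ∀ {n k} → n ≤ suc k → Dominated n k → Dominated n (2 + k)
dominated-+2 {n} {k} n≤1+k dom = begin
    A * (A * A ^ k) + n * (n * n ^ k)   ≡⟨ cong₂ _+_ (*-assoc A A (A ^ k)) (*-assoc n n (n ^ k)) ⟨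
    A * A * A ^ k + n * n * n ^ k       ≤⟨ +-monoʳ-≤ (A * A * A ^ k)
                                             (*-monoˡ-≤ (n ^ k) (*-mono-≤ (n≤n!! n) (n≤n!! n))) ⟩
    A * A * A ^ k + A * A * n ^ k       ≡⟨ *-distribˡ-+ (A * A) (A ^ k) (n ^ k) ⟨
    A * A * (A ^ k + n ^ k)             ≤⟨ *-mono-≤ (≤-trans (n!!²≤[1+n]^n n) (^-monoˡ-≤ n (s≤s n≤1+k))) dom ⟩
    (2 + k) ^ n * k !! ^ n              ≡⟨ ^-distrib-* (2 + k) (k !!) n ⟨
    ((2 + k) * k !!) ^ n                ∎
  where
  A = n !!

dominated-from : ∀ {n k} → n ≤ suc k → Dominated n k → Dominated n (suc k) →
                 ∀ {m} → k ≤ m → Dominated n m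
dominated-from {n} {k} n≤1+k domₖ dom₁₊ₖ k≤m with m≤n⇒∃[o]m+o≡n k≤m
... | d , refl = subst (Dominated n) (+-comm d k) (go d)
  where
  go : ∀ d → Dominated n (d + k)
  go zero          = domₖ
  go (suc zero)    = dom₁₊ₖ
  go (suc (suc d)) = dominated-+2 (≤-trans n≤1+k (s≤s (m≤n+m k d))) (go d)

dominated-1+ : ∀ n → 1 ≤ n → n ≢ 2 → Dominated n (suc n)
dominated-1+ 1 _ _ = ≤-refl
dominated-1+ 2 _ 2≢2 = contradiction refl 2≢2
dominated-1+ 3 _ _ = ≤ᵇ⇒≤ 162 512 _
dominated-1+ n@(suc (suc (suc (suc _)))) _ _ = *-cancelˡ-≤ 2 (begin
    2 * (X + N)        ≡⟨ *-distribˡ-+ 2 X N ⟩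
    2 * X + 2 * N      ≤⟨ +-monoʳ-≤ (2 * X) 2N≤X ⟩
    2 * X + X          ≡⟨ +-comm (2 * X) X ⟩
    3 * X              ≤⟨ 3*n!!^[1+n]≤2*[1+n]!!^n n (s≤s (s≤s (s≤s z≤n))) ⟩
    2 * suc n !! ^ n   ∎)
  where
  X = n !! ^ suc n
  N = n ^ suc n
  2N≤X : 2 * N ≤ X
  2N≤X = begin
    2 * N             ≤⟨ *-monoˡ-≤ N (^-monoʳ-≤ 2 {1} {suc n} (s≤s z≤n)) ⟩
    2 ^ suc n * N     ≡⟨ ^-distrib-* 2 n (suc n) ⟨
    (2 * n) ^ suc n   ≤⟨ ^-monoˡ-≤ (suc n) (2*n≤n!! n (s≤s (s≤s (s≤s (s≤s z≤n))))) ⟩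
    X                 ∎

dominated-2+ : ∀ n → 1 ≤ n → Dominated n (2 + n)
dominated-2+ 1 _ = ≤ᵇ⇒≤ 2 3 _
dominated-2+ n@(suc (suc _)) _ = begin
    A ^ (2 + n) + n ^ (2 + n)   ≤⟨ +-monoʳ-≤ (A ^ (2 + n)) (^-monoˡ-≤ (2 + n) (n≤n!! n)) ⟩
    A ^ (2 + n) + A ^ (2 + n)   ≡⟨ regroup A (A ^ n) ⟩
    2 * (A * A) * A ^ n         ≤⟨ *-monoˡ-≤ (A ^ n) (2*n!!²≤[2+n]^n n (s≤s (s≤s z≤n))) ⟩
    (2 + n) ^ n * A ^ n         ≡⟨ ^-distrib-* (2 + n) A n ⟨
    ((2 + n) * A) ^ n           ∎
  where
  A = n !!
  regroup : ∀ a x → a * (a * x) + a * (a * x) ≡ 2 * (a * a) * x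
  regroup = solve-∀

n!!^k+n^k<k!!^n+k^n : ∀ {n k} → 1 ≤ n → n < k → n !! ^ k + n ^ k < k !! ^ n + k ^ n
n!!^k+n^k<k!!^n+k^n {n} {k} 1≤n n<k with n ≟ 2 | k ≟ 3
... | no n≢2   | _        = dominated⇒< (m<n⇒0<n n<k)
  (dominated-from (m≤n+m n 2) (dominated-1+ n 1≤n n≢2) (dominated-2+ n 1≤n) n<k)
... | yes refl | yes refl = <ᵇ⇒< 16 18 _
... | yes refl | no k≢3   = dominated⇒< (m<n⇒0<n n<k)
  (dominated-from (≤ᵇ⇒≤ 2 5 _) (≤ᵇ⇒≤ 32 64 _) (≤ᵇ⇒≤ 64 225 _) (≤∧≢⇒< n<k (≢-sym k≢3)))

theorem1p2 : ∀ (n k : ℕ) → n ≥ 1 → k ≥ 1 →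
    (((n !!) ^ k + n ^ k ≡ (k !!) ^ n + k ^ n) ⇔ (k ≡ n))
theorem1p2 n k 1≤n 1≤k = mk⇔ sums-equal⇒k≡n k≡n⇒sums-equal
  where
  sums-equal⇒k≡n : n !! ^ k + n ^ k ≡ k !! ^ n + k ^ n → k ≡ n
  sums-equal⇒k≡n eq with <-cmp n k
  ... | tri< n<k _ _ = contradiction eq (<⇒≢ (n!!^k+n^k<k!!^n+k^n 1≤n n<k))
  ... | tri≈ _ n≡k _ = sym n≡k
  ... | tri> _ _ k<n = contradiction (sym eq) (<⇒≢ (n!!^k+n^k<k!!^n+k^n 1≤k k<n))
  k≡n⇒sums-equal : k ≡ n → n !! ^ k + n ^ k ≡ k !! ^ n + k ^ n
  k≡n⇒sums-equal refl = refl
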